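{- Let $r$ be a real number, $s$ a number such that $2s$ is a non-negative integer, and $n$ a non-negative integer. Then \[ \mathcal{L}_{n+2s,r}(x)=\sum_{k=0}^{n}\genfrac{\lfloor}{\rfloor}{0pt}{}{n}{k}_{r+s}x^{k}\,\mathcal{L}_{2s,\,r+\frac{k}{2}}(x). \]
   Context: For a real number $r$ and integers $n,k\ge0$, the $r$-Lah numbers $\genfrac{\lfloor}{\rfloor}{0pt}{}{n}{k}_r$ are defined by $\frac{1}{k!}\left(\frac{t}{1-t}\right)^k\left(\frac{1}{1-t}\right)^{2r}=\sum_{n\ge k}\genfrac{\lfloor}{\rfloor}{0pt}{}{n}{k}_r\frac{t^n}{n!}$ (zero for $k>n$). The exponential $r$-Lah polynomials are $\mathcal{L}_{n,r}(x)=\sum_{k=0}^n\genfrac{\lfloor}{\rfloor}{0pt}{}{n}{k}_r x^k$. -}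

module Defs where

open import Level using (Level)
open import Data.Nat as ℕ using (ℕ; zero; suc; _≤?_; _∸_)
open import Data.Nat.Combinatorics using (_C_)
open import Relation.Nullary using (yes; no)
open import Algebra.Bundles using (CommutativeRing)

-- All definitions are taken inside an arbitrary commutative ring R
-- (the paper works over ℝ).
module _ {c ℓ : Level} (R : CommutativeRing c ℓ) where
  open CommutativeRing R

  natR : ℕ → Carrier
  natR zero    = 0#
  natR (suc n) = 1# + natR n

  powR : Carrier → ℕ → Carrier
  powR x zero    = 1#
  powR x (suc k) = x * powR x k

  rising : Carrier → ℕ → Carrier
  rising a zero    = 1#
  rising a (suc m) = a * rising (a + 1#) m

  sumTo : ℕ → (ℕ → Carrier) → Carrier
  sumTo zero    f = f 0
  sumTo (suc n) f = sumTo n f + f (suc n)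

  -- r-Lah number ⌊n k⌋_r, parametrised by  twoR = 2r.
  -- Coefficient of t^n/n! in (1/k!) (t/(1-t))^k (1-t)^(-2r):
  --   = C(n,k) · (2r+k)(2r+k+1)···(2r+n-1)   for k ≤ n,  and 0 for k > n.
  lahTwice : ℕ → ℕ → Carrier → Carrier
  lahTwice n k twoR with k ≤? n
  ... | yes _ = natR (n C k) * rising (twoR + natR k) (n ∸ k)
  ... | no  _ = 0#

  lahPolyTwice : ℕ → Carrier → Carrier → Carrier
  lahPolyTwice n twoR x = sumTo n (λ k → lahTwice n k twoR * powR x k)

-- Write a for 2r. For j ≤ N the r-Lah number is C(N,j)·(a+j)^(N−j) (rising power), so
-- L_{n+m}(x) = Σ_j C(n+m,j)·(a+j)^(n+m−j)·x^j. Expanding C(n+m,j) by Vandermonde's identity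
-- as Σ_{k+l=j} C(n,k)·C(m,l) and splitting the rising power (a+k+l)^(n+m−k−l) into a run of
-- length m−l followed by a run of length n−k starting at a+m+k, the inner sum over l is
-- L_{m, a+k}(x) and the remaining factor is the r-Lah number ⌊n k⌋ with parameter a+m.
module Submission where

open import Defs
open import Level using (Level)
open import Algebra.Bundles using (CommutativeRing)
open import Data.Nat using (ℕ; zero; suc; _∸_; _≤_; _≤?_; z≤n)
import Data.Nat as ℕ
open import Data.Nat.Properties as ℕₚ
  using (∸-+-assoc; +-∸-comm; +-∸-assoc; m+[n∸m]≡n; m≤n⇒m≤1+n; ≤-refl; n<1+n)
open import Data.Nat.Combinatorics using (_C_; nCk+nC[k+1]≡[n+1]C[k+1]; k>n⇒nCk≡0)
open import Data.Empty using (⊥-elim)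
open import Relation.Nullary using (yes; no)
open import Relation.Binary.PropositionalEquality as ≡ using (_≡_)
import Algebra.Properties.CommutativeSemigroup as CommutativeSemigroupProperties
import Algebra.Solver.CommutativeMonoid as CommutativeMonoidSolver

[n+m]∸[k+l]≡[m∸l]+[n∸k] : ∀ {n m k l} → k ≤ n → l ≤ m → n ℕ.+ m ∸ (k ℕ.+ l) ≡ (m ∸ l) ℕ.+ (n ∸ k)
[n+m]∸[k+l]≡[m∸l]+[n∸k] {n} {m} {k} {l} k≤n l≤m = begin
  n ℕ.+ m ∸ (k ℕ.+ l)     ≡⟨ ∸-+-assoc (n ℕ.+ m) k l ⟨
  n ℕ.+ m ∸ k ∸ l         ≡⟨ ≡.cong (_∸ l) (+-∸-comm m k≤n) ⟩
  (n ∸ k) ℕ.+ m ∸ l       ≡⟨ +-∸-assoc (n ∸ k) l≤m ⟩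
  (n ∸ k) ℕ.+ (m ∸ l)     ≡⟨ ℕₚ.+-comm (n ∸ k) (m ∸ l) ⟩
  (m ∸ l) ℕ.+ (n ∸ k)     ∎
  where open ≡.≡-Reasoning

module _ {c ℓ : Level} (R : CommutativeRing c ℓ) where
  open CommutativeRing R
  open import Relation.Binary.Reasoning.Setoid setoid
  open CommutativeSemigroupProperties +-commutativeSemigroup using (x∙yz≈y∙xz; interchange)
  module *-Solver = CommutativeMonoidSolver *-commutativeMonoid

  sumTo-cong : ∀ M {f g : ℕ → Carrier} → (∀ j → j ≤ M → f j ≈ g j) → sumTo R M f ≈ sumTo R M g
  sumTo-cong zero    f≈g = f≈g 0 z≤n
  sumTo-cong (suc M) f≈g = +-cong (sumTo-cong M (λ j j≤M → f≈g j (m≤n⇒m≤1+n j≤M))) (f≈g (suc M) ≤-refl)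

  sumTo-sucˡ : ∀ M (f : ℕ → Carrier) → sumTo R (suc M) f ≈ f 0 + sumTo R M (λ j → f (suc j))
  sumTo-sucˡ zero    f = refl
  sumTo-sucˡ (suc M) f = trans (+-congʳ (sumTo-sucˡ M f)) (+-assoc _ _ _)

  sumTo-distrib-+ : ∀ M (f g : ℕ → Carrier) →
    sumTo R M (λ j → f j + g j) ≈ sumTo R M f + sumTo R M g
  sumTo-distrib-+ zero    f g = refl
  sumTo-distrib-+ (suc M) f g =
    trans (+-congʳ (sumTo-distrib-+ M f g)) (interchange _ _ _ _)

  *-distribˡ-sumTo : ∀ M a (f : ℕ → Carrier) → a * sumTo R M f ≈ sumTo R M (λ j → a * f j)
  *-distribˡ-sumTo zero    a f = refl
  *-distribˡ-sumTo (suc M) a f = trans (distribˡ a _ _) (+-congʳ (*-distribˡ-sumTo M a f))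

  natR-homo-+ : ∀ m n → natR R (m ℕ.+ n) ≈ natR R m + natR R n
  natR-homo-+ zero    n = sym (+-identityˡ _)
  natR-homo-+ (suc m) n = trans (+-congˡ (natR-homo-+ m n)) (sym (+-assoc _ _ _))

  powR-homo-* : ∀ x m n → powR R x (m ℕ.+ n) ≈ powR R x m * powR R x n
  powR-homo-* x zero    n = sym (*-identityˡ _)
  powR-homo-* x (suc m) n = trans (*-congˡ (powR-homo-* x m n)) (sym (*-assoc _ _ _))

  rising-cong : ∀ {a b} p → a ≈ b → rising R a p ≈ rising R b p
  rising-cong zero    a≈b = refl
  rising-cong (suc p) a≈b = *-cong a≈b (rising-cong p (+-congʳ a≈b))

  rising-+ : ∀ a p q → rising R a (p ℕ.+ q) ≈ rising R a p * rising R (a + natR R p) q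
  rising-+ a zero q = begin
    rising R a q              ≈⟨ rising-cong q (+-identityʳ a) ⟨
    rising R (a + 0#) q       ≈⟨ *-identityˡ _ ⟨
    1# * rising R (a + 0#) q  ∎
  rising-+ a (suc p) q = begin
    a * rising R (a + 1#) (p ℕ.+ q)
      ≈⟨ *-congˡ (rising-+ (a + 1#) p q) ⟩
    a * (rising R (a + 1#) p * rising R ((a + 1#) + natR R p) q)
      ≈⟨ *-assoc _ _ _ ⟨
    a * rising R (a + 1#) p * rising R ((a + 1#) + natR R p) q
      ≈⟨ *-congˡ (rising-cong q (+-assoc _ _ _)) ⟩
    a * rising R (a + 1#) p * rising R (a + (1# + natR R p)) q ∎

  sumTo-binomial-suc : ∀ M (g : ℕ → Carrier) →
    sumTo R (suc M) (λ j → natR R (suc M C j) * g j)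
      ≈ sumTo R M (λ j → natR R (M C j) * g j) + sumTo R M (λ j → natR R (M C j) * g (suc j))
  sumTo-binomial-suc M g = begin
    sumTo R (suc M) (λ j → natR R (suc M C j) * g j)
      ≈⟨ sumTo-sucˡ M _ ⟩
    natR R 1 * g 0 + sumTo R M (λ j → natR R (suc M C suc j) * g (suc j))
      ≈⟨ +-congˡ (sumTo-cong M (λ j _ → pascal j)) ⟩
    natR R 1 * g 0 + sumTo R M (λ j → natR R (M C j) * g (suc j) + natR R (M C suc j) * g (suc j))
      ≈⟨ +-congˡ (sumTo-distrib-+ M _ _) ⟩
    natR R 1 * g 0 + (Σ-shifted + sumTo R M (λ j → natR R (M C suc j) * g (suc j)))
      ≈⟨ x∙yz≈y∙xz _ _ _ ⟩
    Σ-shifted + (natR R 1 * g 0 + sumTo R M (λ j → natR R (M C suc j) * g (suc j)))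
      ≈⟨ +-congˡ (sumTo-sucˡ M _) ⟨
    Σ-shifted + sumTo R (suc M) (λ j → natR R (M C j) * g j)
      ≈⟨ +-congˡ (trans (+-congˡ last-vanishes) (+-identityʳ _)) ⟩
    Σ-shifted + sumTo R M (λ j → natR R (M C j) * g j)
      ≈⟨ +-comm _ _ ⟩
    sumTo R M (λ j → natR R (M C j) * g j) + Σ-shifted ∎
    where
    Σ-shifted : Carrier
    Σ-shifted = sumTo R M (λ j → natR R (M C j) * g (suc j))

    pascal : ∀ j → natR R (suc M C suc j) * g (suc j)
                     ≈ natR R (M C j) * g (suc j) + natR R (M C suc j) * g (suc j)
    pascal j = begin
      natR R (suc M C suc j) * g (suc j)
        ≡⟨ ≡.cong (λ b → natR R b * g (suc j)) (nCk+nC[k+1]≡[n+1]C[k+1] M j) ⟨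
      natR R (M C j ℕ.+ M C suc j) * g (suc j)
        ≈⟨ trans (*-congʳ (natR-homo-+ (M C j) (M C suc j))) (distribʳ _ _ _) ⟩
      natR R (M C j) * g (suc j) + natR R (M C suc j) * g (suc j) ∎

    last-vanishes : natR R (M C suc M) * g (suc M) ≈ 0#
    last-vanishes = trans (*-congʳ (reflexive (≡.cong (natR R) (k>n⇒nCk≡0 (n<1+n M))))) (zeroˡ _)

  sumTo-binomial-+ : ∀ n m (h : ℕ → Carrier) →
    sumTo R (n ℕ.+ m) (λ j → natR R ((n ℕ.+ m) C j) * h j)
      ≈ sumTo R n (λ k → natR R (n C k) * sumTo R m (λ l → natR R (m C l) * h (k ℕ.+ l)))
  sumTo-binomial-+ zero    m h = sym (trans (*-congʳ (+-identityʳ 1#)) (*-identityˡ _))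
  sumTo-binomial-+ (suc n) m h = begin
    sumTo R (suc (n ℕ.+ m)) (λ j → natR R (suc (n ℕ.+ m) C j) * h j)
      ≈⟨ sumTo-binomial-suc (n ℕ.+ m) h ⟩
    sumTo R (n ℕ.+ m) (λ j → natR R ((n ℕ.+ m) C j) * h j)
      + sumTo R (n ℕ.+ m) (λ j → natR R ((n ℕ.+ m) C j) * h (suc j))
      ≈⟨ +-cong (sumTo-binomial-+ n m h) (sumTo-binomial-+ n m (λ j → h (suc j))) ⟩
    sumTo R n (λ k → natR R (n C k) * inner k) + sumTo R n (λ k → natR R (n C k) * inner (suc k))
      ≈⟨ sumTo-binomial-suc n inner ⟨
    sumTo R (suc n) (λ k → natR R (suc n C k) * inner k) ∎
    where
    inner : ℕ → Carrier
    inner k = sumTo R m (λ l → natR R (m C l) * h (k ℕ.+ l))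

  risingTerm : ℕ → Carrier → Carrier → ℕ → Carrier
  risingTerm N a x j = rising R (a + natR R j) (N ∸ j) * powR R x j

  lahTwice-≤ : ∀ {N j} a → j ≤ N → lahTwice R N j a ≈ natR R (N C j) * rising R (a + natR R j) (N ∸ j)
  lahTwice-≤ {N} {j} a j≤N with j ≤? N
  ... | yes _   = refl
  ... | no  j≰N = ⊥-elim (j≰N j≤N)

  lahPolyTwice-binomial : ∀ N a x →
    lahPolyTwice R N a x ≈ sumTo R N (λ j → natR R (N C j) * risingTerm N a x j)
  lahPolyTwice-binomial N a x =
    sumTo-cong N (λ j j≤N → trans (*-congʳ (lahTwice-≤ a j≤N)) (*-assoc _ _ _))

  rising-split : ∀ a {n m k l} → k ≤ n → l ≤ m →
    rising R (a + natR R (k ℕ.+ l)) (n ℕ.+ m ∸ (k ℕ.+ l))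
      ≈ rising R ((a + natR R k) + natR R l) (m ∸ l) * rising R ((a + natR R m) + natR R k) (n ∸ k)
  rising-split a {n} {m} {k} {l} k≤n l≤m = begin
    rising R (a + natR R (k ℕ.+ l)) (n ℕ.+ m ∸ (k ℕ.+ l))
      ≈⟨ rising-cong (n ℕ.+ m ∸ (k ℕ.+ l)) (trans (+-congˡ (natR-homo-+ k l)) (sym (+-assoc a _ _))) ⟩
    rising R b (n ℕ.+ m ∸ (k ℕ.+ l))
      ≡⟨ ≡.cong (rising R b) ([n+m]∸[k+l]≡[m∸l]+[n∸k] k≤n l≤m) ⟩
    rising R b ((m ∸ l) ℕ.+ (n ∸ k))
      ≈⟨ rising-+ b (m ∸ l) (n ∸ k) ⟩
    rising R b (m ∸ l) * rising R (b + natR R (m ∸ l)) (n ∸ k)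
      ≈⟨ *-congˡ (rising-cong (n ∸ k) run-end) ⟩
    rising R b (m ∸ l) * rising R ((a + natR R m) + natR R k) (n ∸ k) ∎
    where
    b : Carrier
    b = (a + natR R k) + natR R l

    run-end : b + natR R (m ∸ l) ≈ (a + natR R m) + natR R k
    run-end = begin
      ((a + natR R k) + natR R l) + natR R (m ∸ l)  ≈⟨ +-assoc _ _ _ ⟩
      (a + natR R k) + (natR R l + natR R (m ∸ l))  ≈⟨ +-congˡ (natR-homo-+ l (m ∸ l)) ⟨
      (a + natR R k) + natR R (l ℕ.+ (m ∸ l))         ≡⟨ ≡.cong (λ i → (a + natR R k) + natR R i) (m+[n∸m]≡n l≤m) ⟩
      (a + natR R k) + natR R m                     ≈⟨ +-assoc _ _ _ ⟩
      a + (natR R k + natR R m)                     ≈⟨ +-congˡ (+-comm _ _) ⟩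
      a + (natR R m + natR R k)                     ≈⟨ +-assoc _ _ _ ⟨
      (a + natR R m) + natR R k                     ∎

  lahTwice-monomial-product : ∀ a x {n m k l} → k ≤ n → l ≤ m →
    lahTwice R n k (a + natR R m) * powR R x k * (lahTwice R m l (a + natR R k) * powR R x l)
      ≈ natR R (n C k) * (natR R (m C l) * risingTerm (n ℕ.+ m) a x (k ℕ.+ l))
  lahTwice-monomial-product a x {n} {m} {k} {l} k≤n l≤m = begin
    lahTwice R n k (a + natR R m) * X * (lahTwice R m l (a + natR R k) * Y)
      ≈⟨ *-cong (*-congʳ (lahTwice-≤ _ k≤n)) (*-congʳ (lahTwice-≤ _ l≤m)) ⟩
    Cn * Outer * X * (Cm * Inner * Y)
      ≈⟨ *-Solver.solve 6 (λ cn o x cm i y →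
           ((cn ⊕ o) ⊕ x) ⊕ ((cm ⊕ i) ⊕ y) ⊜ cn ⊕ (cm ⊕ ((i ⊕ o) ⊕ (x ⊕ y))))
           refl Cn Outer X Cm Inner Y ⟩
    Cn * (Cm * (Inner * Outer * (X * Y)))
      ≈⟨ *-congˡ (*-congˡ (*-cong (rising-split a k≤n l≤m) (powR-homo-* x k l))) ⟨
    Cn * (Cm * risingTerm (n ℕ.+ m) a x (k ℕ.+ l)) ∎
    where
    open *-Solver using (_⊕_; _⊜_)
    Cn Cm X Y Outer Inner : Carrier
    Cn    = natR R (n C k)
    Cm    = natR R (m C l)
    X     = powR R x k
    Y     = powR R x l
    Outer = rising R ((a + natR R m) + natR R k) (n ∸ k)
    Inner = rising R ((a + natR R k) + natR R l) (m ∸ l)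

  lahTwice-monomial-*-lahPolyTwice : ∀ a x m {n k} → k ≤ n →
    lahTwice R n k (a + natR R m) * powR R x k * lahPolyTwice R m (a + natR R k) x
      ≈ natR R (n C k) * sumTo R m (λ l → natR R (m C l) * risingTerm (n ℕ.+ m) a x (k ℕ.+ l))
  lahTwice-monomial-*-lahPolyTwice a x m {n} {k} k≤n = begin
    lahTwice R n k (a + natR R m) * powR R x k * lahPolyTwice R m (a + natR R k) x
      ≈⟨ *-distribˡ-sumTo m _ _ ⟩
    sumTo R m (λ l → lahTwice R n k (a + natR R m) * powR R x k
                       * (lahTwice R m l (a + natR R k) * powR R x l))
      ≈⟨ sumTo-cong m (λ l l≤m → lahTwice-monomial-product a x k≤n l≤m) ⟩
    sumTo R m (λ l → natR R (n C k) * (natR R (m C l) * risingTerm (n ℕ.+ m) a x (k ℕ.+ l)))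
      ≈⟨ *-distribˡ-sumTo m _ _ ⟨
    natR R (n C k) * sumTo R m (λ l → natR R (m C l) * risingTerm (n ℕ.+ m) a x (k ℕ.+ l)) ∎

  lahPolyTwice-+ : ∀ a x m n →
    lahPolyTwice R (n ℕ.+ m) a x
      ≈ sumTo R n (λ k → lahTwice R n k (a + natR R m) * powR R x k * lahPolyTwice R m (a + natR R k) x)
  lahPolyTwice-+ a x m n = begin
    lahPolyTwice R (n ℕ.+ m) a x
      ≈⟨ lahPolyTwice-binomial (n ℕ.+ m) a x ⟩
    sumTo R (n ℕ.+ m) (λ j → natR R ((n ℕ.+ m) C j) * risingTerm (n ℕ.+ m) a x j)
      ≈⟨ sumTo-binomial-+ n m (risingTerm (n ℕ.+ m) a x) ⟩
    sumTo R n (λ k → natR R (n C k) * sumTo R m (λ l → natR R (m C l) * risingTerm (n ℕ.+ m) a x (k ℕ.+ l)))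
      ≈⟨ sumTo-cong n (λ k k≤n → lahTwice-monomial-*-lahPolyTwice a x m k≤n) ⟨
    sumTo R n (λ k → lahTwice R n k (a + natR R m) * powR R x k * lahPolyTwice R m (a + natR R k) x) ∎

mainTheorem8 : ∀ {c ℓ : Level} (R : CommutativeRing c ℓ) → let open CommutativeRing R in
    ∀ (r x : Carrier) (m n : ℕ) →
    lahPolyTwice R (n Data.Nat.+ m) (r + r) x
      ≈ sumTo R n (λ k → lahTwice R n k ((r + r) + natR R m) * powR R x k
                           * lahPolyTwice R m ((r + r) + natR R k) x)
mainTheorem8 R r = lahPolyTwice-+ R (CommutativeRing._+_ R r r)
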